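{- A modified ascent sequence avoids $213$ if and only if it avoids $1213$, and it avoids $312$ if and only if it avoids $1312$. That is, $\mathrm{Modasc}(213)=\mathrm{Modasc}(1213)$ and $\mathrm{Modasc}(312)=\mathrm{Modasc}(1312)$.
   Context: A Cayley permutation of length $n$ is a word $x=x_1\cdots x_n$ of positive integers whose set of values is $\{1,\dots,k\}$ for some $k\le n$. $x$ contains $y=y_1\cdots y_k$ if there are indices $i_1<\cdots<i_k$ with $x_{i_s}<x_{i_t}\iff y_s<y_t$ and $x_{i_s}=x_{i_t}\iff y_s=y_t$ for all $s,t$; otherwise $x$ avoids $y$. The ascent tops of $x$ are the pairs $(1,x_1)$ and $(i,x_i)$ with $1<i\le n$ and $x_{i-1}<x_i$; the leftmost copies are the pairs $(\min\{i:x_i=j\},j)$ for $1\le j\le\max(x)$. A modified ascent sequence is a Cayley permutation whose set of ascent tops equals its set of leftmost copies. $\mathrm{Modasc}(y)$ is the set of modified ascent sequences avoiding $y$. -}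

module Defs where

open import Data.Nat using (ℕ; zero; suc; _<_; _≤_)
open import Data.List using (List; []; _∷_; length; lookup)
open import Data.List.Relation.Binary.Sublist.Propositional using (_⊆_)
open import Data.Fin using (Fin; toℕ; cast)
open import Data.Product using (Σ; ∃; _×_)
open import Data.Sum using (_⊎_)
open import Function.Bundles using (_⇔_)
open import Relation.Binary.PropositionalEquality using (_≡_; _≢_)
open import Relation.Nullary using (¬_)

-- Words are lists of naturals; positions are Fin (length x), 0-based.

-- Cayley permutation: all letters positive, and every j with 1 ≤ j ≤ (some letter) occurs,
-- i.e. the set of values is {1,…,k} for some k.
IsCayley : List ℕ → Set
IsCayley x =
  (∀ (i : Fin (length x)) → 1 ≤ lookup x i) ×
  (∀ (i : Fin (length x)) (j : ℕ) → 1 ≤ j → j ≤ lookup x i →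
     ∃ λ (k : Fin (length x)) → lookup x k ≡ j)

OrderIso : List ℕ → List ℕ → Set
OrderIso z y =
  Σ (length z ≡ length y) λ eq →
    ∀ (s t : Fin (length z)) →
      ((lookup z s < lookup z t) ⇔ (lookup y (cast eq s) < lookup y (cast eq t))) ×
      ((lookup z s ≡ lookup z t) ⇔ (lookup y (cast eq s) ≡ lookup y (cast eq t)))

Contains : List ℕ → List ℕ → Set
Contains x y = ∃ λ z → (z ⊆ x) × OrderIso z y

Avoids : List ℕ → List ℕ → Set
Avoids x y = ¬ Contains x y

IsAscentTop : (x : List ℕ) → Fin (length x) → Set
IsAscentTop x i =
  toℕ i ≡ 0 ⊎
  (∃ λ (j : Fin (length x)) → (suc (toℕ j) ≡ toℕ i) × (lookup x j < lookup x i))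

IsLeftmostCopy : (x : List ℕ) → Fin (length x) → Set
IsLeftmostCopy x i =
  ∀ (j : Fin (length x)) → toℕ j < toℕ i → lookup x j ≢ lookup x i

-- modified ascent sequence: Cayley permutation whose set of ascent tops
-- {(i, x_i)} equals its set of leftmost copies {(i, x_i)}; since both sets consist
-- of pairs (i, x_i), equality amounts to agreement at every position i.
IsModAsc : List ℕ → Set
IsModAsc x = IsCayley x × (∀ (i : Fin (length x)) → IsAscentTop x i ⇔ IsLeftmostCopy x i)

InModasc : List ℕ → List ℕ → Set
InModasc y x = IsModAsc x × Avoids x y

-- In a modified ascent sequence every descent x_i > x_j (i < j) is straddled by a repeated
-- value: there are p < i < q ≤ j with x_p = x_q ≤ x_j. Indeed, going back from j, either x_j
-- repeats an earlier letter or, being a leftmost copy, it is an ascent top, so x_{j-1} < x_j;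
-- in both cases we reach a letter no larger than x_j at an earlier position, and we continue
-- until the repeat lands left of i. Hence an occurrence x_i x_j x_k of 213 or 312 extends to
-- the occurrence x_p x_i x_q x_k of 1213 or 1312; conversely, dropping the first letter of an
-- occurrence of 1213 or 1312 leaves one of 213 or 312.
module Submission where

open import Defs
open import Data.Nat as ℕ using (ℕ; zero; suc; z≤n; z<s; s<s; _+_)
open import Data.Nat.Properties as ℕ
  using (<-cmp; <-irrefl; <-asym; <-trans; ≤-<-trans; <-≤-trans; <⇒≤; ≤-refl; ≤-reflexive;
         m≤n+m; +-monoˡ-<)
open import Data.Fin as Fin using (Fin; zero; suc; toℕ; cast)
open import Data.Fin.Properties as Fin using (any?; cast-trans; cast-involutive; toℕ-cast)
open import Data.Fin.Induction using (<-wellFounded)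
open import Data.List using (List; []; _∷_; length; lookup; map)
open import Data.List.Properties using (length-map; map-∘)
open import Data.List.Relation.Binary.Sublist.Propositional using (_⊆_; []; _∷_; _∷ʳ_; minimum)
open import Data.List.Relation.Binary.Sublist.Propositional.Properties using (∷ˡ⁻)
open import Data.List.Relation.Unary.Linked as Linked using (Linked; []; [-]; _∷_)
open import Data.List.Relation.Unary.Linked.Properties using (map⁻)
open import Data.Product using (∃; _×_; _,_; proj₁; proj₂)
open import Data.Sum using (_⊎_; inj₁; inj₂)
open import Data.Empty using (⊥-elim)
open import Function using (_∘_)
open import Function.Bundles using (_⇔_; mk⇔; Equivalence)
open import Induction.WellFounded using (Acc; acc)
open import Relation.Binary.Core using (_Preserves_⟶_)
open import Relation.Binary.Definitions using (tri<; tri≈; tri>)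
open import Relation.Binary.PropositionalEquality using (_≡_; refl; sym; trans; cong; subst; subst₂)
open import Relation.Nullary using (yes; no)
open import Relation.Nullary.Decidable using (_×-dec_)

open Equivalence using (from)

module _ {f : ℕ → ℕ} (f↑ : f Preserves ℕ._<_ ⟶ ℕ._<_) where

  increasing-reflects-< : ∀ {m n} → f m ℕ.< f n → m ℕ.< n
  increasing-reflects-< {m} {n} fm<fn with <-cmp m n
  ... | tri< m<n _ _ = m<n
  ... | tri≈ _ refl _ = ⊥-elim (<-irrefl refl fm<fn)
  ... | tri> _ _ n<m = ⊥-elim (<-asym fm<fn (f↑ n<m))

  increasing-injective : ∀ {m n} → f m ≡ f n → m ≡ n
  increasing-injective {m} {n} fm≡fn with <-cmp m n
  ... | tri< m<n _ _ = ⊥-elim (<-irrefl fm≡fn (f↑ m<n))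
  ... | tri≈ _ m≡n _ = m≡n
  ... | tri> _ _ n<m = ⊥-elim (<-irrefl (sym fm≡fn) (f↑ n<m))

SameOrder : ℕ → ℕ → ℕ → ℕ → Set
SameOrder a b c d = ((a ℕ.< b) ⇔ (c ℕ.< d)) × ((a ≡ b) ⇔ (c ≡ d))

increasing-sameOrder : ∀ {f g : ℕ → ℕ} → f Preserves ℕ._<_ ⟶ ℕ._<_ → g Preserves ℕ._<_ ⟶ ℕ._<_ →
                       ∀ m n → SameOrder (f m) (f n) (g m) (g n)
increasing-sameOrder {f} {g} f↑ g↑ m n =
  mk⇔ (g↑ ∘ increasing-reflects-< f↑) (f↑ ∘ increasing-reflects-< g↑) ,
  mk⇔ (cong g ∘ increasing-injective f↑) (cong f ∘ increasing-injective g↑)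

lookup-map : ∀ (f : ℕ → ℕ) (ys : List ℕ) (s : Fin (length (map f ys))) →
             lookup (map f ys) s ≡ f (lookup ys (cast (length-map f ys) s))
lookup-map f (y ∷ ys) zero    = refl
lookup-map f (y ∷ ys) (suc s) = lookup-map f ys s

orderIso-map : ∀ {f g : ℕ → ℕ} → f Preserves ℕ._<_ ⟶ ℕ._<_ → g Preserves ℕ._<_ ⟶ ℕ._<_ →
               ∀ ys → OrderIso (map f ys) (map g ys)
orderIso-map {f} {g} f↑ g↑ ys = same-length , same-order
  where
  same-length : length (map f ys) ≡ length (map g ys)
  same-length = trans (length-map f ys) (sym (length-map g ys))

  lookup-g : ∀ s → lookup (map g ys) (cast same-length s) ≡ g (lookup ys (cast (length-map f ys) s))
  lookup-g s = trans (lookup-map g ys (cast same-length s))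
                     (cong (g ∘ lookup ys) (cast-trans same-length (length-map g ys) s))

  same-order : ∀ s t → SameOrder (lookup (map f ys) s) (lookup (map f ys) t)
                                 (lookup (map g ys) (cast same-length s))
                                 (lookup (map g ys) (cast same-length t))
  same-order s t rewrite lookup-map f ys s | lookup-map f ys t | lookup-g s | lookup-g t =
    increasing-sameOrder f↑ g↑ _ _

-- n + c rather than c + n, so that the value at 2 is c definitionally.
interpolate₃ : ℕ → ℕ → ℕ → ℕ → ℕ
interpolate₃ a b c 0             = a
interpolate₃ a b c 1             = b
interpolate₃ a b c (suc (suc n)) = n + c

interpolate₃-increasing : ∀ {a b c} → a ℕ.< b → b ℕ.< c →
                          interpolate₃ a b c Preserves ℕ._<_ ⟶ ℕ._<_
interpolate₃-increasing a<b b<c {0}           {1}           _ = a<b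
interpolate₃-increasing a<b b<c {0}           {suc (suc n)} _ = <-≤-trans (<-trans a<b b<c) (m≤n+m _ n)
interpolate₃-increasing a<b b<c {1}           {1}           (s<s ())
interpolate₃-increasing a<b b<c {1}           {suc (suc n)} _ = <-≤-trans b<c (m≤n+m _ n)
interpolate₃-increasing a<b b<c {suc (suc m)} {suc (suc n)} (s<s (s<s m<n)) = +-monoˡ-< _ m<n

⊆-index : ∀ {xs ys : List ℕ} → xs ⊆ ys → Fin (length xs) → Fin (length ys)
⊆-index (y ∷ʳ τ) s       = suc (⊆-index τ s)
⊆-index (_ ∷ τ)  zero    = zero
⊆-index (_ ∷ τ)  (suc s) = suc (⊆-index τ s)

lookup-⊆-index : ∀ {xs ys : List ℕ} (τ : xs ⊆ ys) s → lookup ys (⊆-index τ s) ≡ lookup xs s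
lookup-⊆-index (y ∷ʳ τ)   s       = lookup-⊆-index τ s
lookup-⊆-index (x≡y ∷ τ) zero    = sym x≡y
lookup-⊆-index (_ ∷ τ)    (suc s) = lookup-⊆-index τ s

⊆-index-increasing : ∀ {xs ys : List ℕ} (τ : xs ⊆ ys) {s t} → s Fin.< t → ⊆-index τ s Fin.< ⊆-index τ t
⊆-index-increasing (y ∷ʳ τ) s<t               = s<s (⊆-index-increasing τ s<t)
⊆-index-increasing (_ ∷ τ)  {zero}  {suc t} _ = z<s
⊆-index-increasing (_ ∷ τ)  {suc s} {suc t} (s<s s<t) = s<s (⊆-index-increasing τ s<t)

Linked-zero∷ : ∀ {n} {i : Fin (suc n)} {is} → Linked Fin._<_ (i ∷ is) → Linked Fin._<_ (zero ∷ is)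
Linked-zero∷ [-]          = [-]
Linked-zero∷ (i<j ∷ j<is) = <-≤-trans z<s i<j ∷ j<is

positive-positions : ∀ {n} (is : List (Fin (suc n))) → Linked Fin._<_ (zero ∷ is) →
                     ∃ λ js → is ≡ map suc js × Linked Fin._<_ js
positive-positions []           _          = [] , refl , []
positive-positions (suc i ∷ is) (_ ∷ i<is) with positive-positions is (Linked-zero∷ i<is)
... | js , refl , js↑ = i ∷ js , refl , Linked.map ℕ.s<s⁻¹ (map⁻ i<is)

lookup-⊆ : ∀ (xs : List ℕ) (is : List (Fin (length xs))) → Linked Fin._<_ is → map (lookup xs) is ⊆ xs
lookup-⊆-tail : ∀ x (xs : List ℕ) (is : List (Fin (length (x ∷ xs)))) → Linked Fin._<_ (zero ∷ is) →
                map (lookup (x ∷ xs)) is ⊆ xs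

lookup-⊆ xs       []           _   = minimum xs
lookup-⊆ (x ∷ xs) (zero ∷ is)  is↑ = refl ∷ lookup-⊆-tail x xs is is↑
lookup-⊆ (x ∷ xs) (suc i ∷ is) is↑ = x ∷ʳ lookup-⊆-tail x xs (suc i ∷ is) (z<s ∷ is↑)

lookup-⊆-tail x xs is is↑ with positive-positions is is↑
... | js , refl , js↑ = subst (_⊆ xs) (map-∘ js) (lookup-⊆ xs js js↑)

-- A pattern is written as map suc ys with ys using the letter 0, so that the relabelling f
-- of ys may take any value at 0 (it need not leave room below it).
contains-relabelled : ∀ {x f} → f Preserves ℕ._<_ ⟶ ℕ._<_ → ∀ ys (is : List (Fin (length x))) →
                      Linked Fin._<_ is → map (lookup x) is ≡ map f ys → Contains x (map suc ys)
contains-relabelled {x} {f} f↑ ys is is↑ values =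
  map f ys , subst (_⊆ x) values (lookup-⊆ x is is↑) , orderIso-map f↑ s<s ys

contains-tail : ∀ {x y ys} → Contains x (y ∷ ys) → Contains x ys
contains-tail (a ∷ z , τ , eq , iso) = z , ∷ˡ⁻ τ , ℕ.suc-injective eq , λ s t → iso (suc s) (suc t)

record Occurrence (x y : List ℕ) : Set where
  field
    position            : Fin (length y) → Fin (length x)
    position-increasing : ∀ {s t} → s Fin.< t → position s Fin.< position t
    position-<          : ∀ {s t} → lookup y s ℕ.< lookup y t →
                          lookup x (position s) ℕ.< lookup x (position t)

occurrence : ∀ {x y} → Contains x y → Occurrence x y
occurrence {x} {y} (z , τ , eq , iso) = record
  { position            = ⊆-index τ ∘ back
  ; position-increasing = λ {s} {t} s<t → ⊆-index-increasing τ
      (subst₂ ℕ._<_ (sym (toℕ-cast (sym eq) s)) (sym (toℕ-cast (sym eq) t)) s<t)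
  ; position-<          = λ {s} {t} → through-z s t
  }
  where
  back : Fin (length y) → Fin (length z)
  back = cast (sym eq)

  back-forth : ∀ s → lookup y s ≡ lookup y (cast eq (back s))
  back-forth s = cong (lookup y) (sym (cast-involutive eq (sym eq) s))

  through-z : ∀ s t → lookup y s ℕ.< lookup y t →
              lookup x (⊆-index τ (back s)) ℕ.< lookup x (⊆-index τ (back t))
  through-z s t ys<yt
    rewrite lookup-⊆-index τ (back s) | lookup-⊆-index τ (back t) =
      from (proj₁ (iso (back s) (back t)))
        (subst₂ ℕ._<_ (back-forth s) (back-forth t) ys<yt)

record RepeatedPrefix (x : List ℕ) (i j k : Fin (length x)) : Set where
  field
    p q        : Fin (length x)
    increasing : Linked Fin._<_ (p ∷ i ∷ q ∷ k ∷ [])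
    repeat     : lookup x p ≡ lookup x q
    p-below    : lookup x p ℕ.≤ lookup x j

record StraddlingRepeat (x : List ℕ) (i j : Fin (length x)) : Set where
  field
    p q      : Fin (length x)
    p<i      : p Fin.< i
    i<q      : i Fin.< q
    q≤j      : q Fin.≤ j
    repeat   : lookup x p ≡ lookup x q
    q-below  : lookup x q ℕ.≤ lookup x j

module _ {x : List ℕ} (leftmost⇒ascent : ∀ i → IsLeftmostCopy x i → IsAscentTop x i) where

  descent-step : ∀ {i j} → i Fin.< j → lookup x j ℕ.< lookup x i →
                 (∃ λ l → l Fin.< i × lookup x l ≡ lookup x j) ⊎
                 (∃ λ l → i Fin.< l × l Fin.< j × lookup x l ℕ.≤ lookup x j)
  descent-step {i} {j} i<j xj<xi with any? (λ l → (l Fin.<? j) ×-dec (lookup x l ℕ.≟ lookup x j))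
  ... | yes (l , l<j , xl≡xj) with Fin.<-cmp l i
  ...   | tri< l<i _ _ = inj₁ (l , l<i , xl≡xj)
  ...   | tri≈ _ refl _ = ⊥-elim (<-irrefl (sym xl≡xj) xj<xi)
  ...   | tri> _ _ i<l = inj₂ (l , i<l , l<j , ≤-reflexive xl≡xj)
  descent-step {i} {j} i<j xj<xi | no no-earlier-copy
    with leftmost⇒ascent j (λ l l<j xl≡xj → no-earlier-copy (l , l<j , xl≡xj))
  ... | inj₁ j≡0 = ⊥-elim (<-irrefl (sym j≡0) (≤-<-trans z≤n i<j))
  ... | inj₂ (m , 1+m≡j , xm<xj) with Fin.<-cmp i m
  ...   | tri< i<m _ _ = inj₂ (m , i<m , subst (toℕ m ℕ.<_) 1+m≡j ≤-refl , <⇒≤ xm<xj)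
  ...   | tri≈ _ refl _ = ⊥-elim (<-asym xm<xj xj<xi)
  ...   | tri> _ _ m<i = ⊥-elim (<-irrefl 1+m≡j (<-≤-trans (s<s m<i) i<j))

  straddlingRepeat : ∀ {i j} → i Fin.< j → lookup x j ℕ.< lookup x i → StraddlingRepeat x i j
  straddlingRepeat {i} {j} = go (<-wellFounded j)
    where
    go : ∀ {j} → Acc Fin._<_ j → i Fin.< j → lookup x j ℕ.< lookup x i → StraddlingRepeat x i j
    go {j} (acc rec) i<j xj<xi with descent-step i<j xj<xi
    ... | inj₁ (p , p<i , xp≡xj) = record
      { p = p ; q = j ; p<i = p<i ; i<q = i<j ; q≤j = ≤-refl ; repeat = xp≡xj ; q-below = ≤-refl }
    ... | inj₂ (l , i<l , l<j , xl≤xj) = record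
      { StraddlingRepeat r
      ; q≤j     = ℕ.≤-trans q≤j (<⇒≤ l<j)
      ; q-below = ℕ.≤-trans q-below xl≤xj
      }
      where
      r : StraddlingRepeat x i l
      r = go (rec l<j) i<l (≤-<-trans xl≤xj xj<xi)
      open StraddlingRepeat r

  repeatedPrefix : ∀ {i j k} → i Fin.< j → j Fin.< k → lookup x j ℕ.< lookup x i → RepeatedPrefix x i j k
  repeatedPrefix i<j j<k xj<xi = record
    { p          = p
    ; q          = q
    ; increasing = p<i ∷ i<q ∷ ≤-<-trans q≤j j<k ∷ [-]
    ; repeat     = repeat
    ; p-below    = subst (ℕ._≤ _) (sym repeat) q-below
    }
    where open StraddlingRepeat (straddlingRepeat i<j xj<xi)

module _ {x : List ℕ} (modasc : IsModAsc x) where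

  private
    leftmost⇒ascent : ∀ i → IsLeftmostCopy x i → IsAscentTop x i
    leftmost⇒ascent i = from (proj₂ modasc i)

  occurrence-repeatedPrefix : ∀ {u v w} (o : Occurrence x (u ∷ v ∷ w ∷ [])) → v ℕ.< u →
                              let open Occurrence o in
                              RepeatedPrefix x (position zero) (position (suc zero)) (position (suc (suc zero)))
  occurrence-repeatedPrefix o v<u =
    repeatedPrefix leftmost⇒ascent (position-increasing z<s) (position-increasing (s<s z<s)) (position-< v<u)
    where open Occurrence o

  contains-213⇒1213 : Contains x (2 ∷ 1 ∷ 3 ∷ []) → Contains x (1 ∷ 2 ∷ 1 ∷ 3 ∷ [])
  contains-213⇒1213 c =
    contains-relabelled (interpolate₃-increasing (≤-<-trans p-below xj<xi) xi<xk)
      (0 ∷ 1 ∷ 0 ∷ 2 ∷ []) (p ∷ i ∷ q ∷ k ∷ []) increasing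
      (cong (λ v → lookup x p ∷ lookup x i ∷ v ∷ lookup x k ∷ []) (sym repeat))
    where
    o = occurrence c
    open Occurrence o
    open RepeatedPrefix (occurrence-repeatedPrefix o (s<s z<s))
    i j k : Fin (length x)
    i = position zero
    j = position (suc zero)
    k = position (suc (suc zero))
    xj<xi : lookup x j ℕ.< lookup x i
    xj<xi = position-< (s<s z<s)
    xi<xk : lookup x i ℕ.< lookup x k
    xi<xk = position-< (s<s (s<s z<s))

  contains-312⇒1312 : Contains x (3 ∷ 1 ∷ 2 ∷ []) → Contains x (1 ∷ 3 ∷ 1 ∷ 2 ∷ [])
  contains-312⇒1312 c =
    contains-relabelled (interpolate₃-increasing (≤-<-trans p-below xj<xk) xk<xi)
      (0 ∷ 2 ∷ 0 ∷ 1 ∷ []) (p ∷ i ∷ q ∷ k ∷ []) increasing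
      (cong (λ v → lookup x p ∷ lookup x i ∷ v ∷ lookup x k ∷ []) (sym repeat))
    where
    o = occurrence c
    open Occurrence o
    open RepeatedPrefix (occurrence-repeatedPrefix o (s<s z<s))
    i j k : Fin (length x)
    i = position zero
    j = position (suc zero)
    k = position (suc (suc zero))
    xj<xk : lookup x j ℕ.< lookup x k
    xj<xk = position-< (s<s z<s)
    xk<xi : lookup x k ℕ.< lookup x i
    xk<xi = position-< (s<s (s<s z<s))

InModasc⇔InModasc-∷ : ∀ {y} c → (∀ {x} → IsModAsc x → Contains x y → Contains x (c ∷ y)) →
                    ∀ x → InModasc y x ⇔ InModasc (c ∷ y) x
InModasc⇔InModasc-∷ c extend x =
  mk⇔ (λ (modasc , avoids) → modasc , avoids ∘ contains-tail)
      (λ (modasc , avoids) → modasc , avoids ∘ extend modasc)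

proposition5p9 : (∀ (x : List ℕ) → InModasc (2 ∷ 1 ∷ 3 ∷ []) x ⇔ InModasc (1 ∷ 2 ∷ 1 ∷ 3 ∷ []) x)
    × (∀ (x : List ℕ) → InModasc (3 ∷ 1 ∷ 2 ∷ []) x ⇔ InModasc (1 ∷ 3 ∷ 1 ∷ 2 ∷ []) x)
proposition5p9 = InModasc⇔InModasc-∷ 1 contains-213⇒1213 , InModasc⇔InModasc-∷ 1 contains-312⇒1312
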